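{- Let $G\in\mathbb{Im}^\infty$, let $S_G$ be its set of immediate nimbers and $P_G$ its set of protected nimbers, and let $\mathcal{N}$ denote the set of all nimbers (affine impartial games equal to nimbers). Then: (i) if $S_G\cup P_G=\mathcal{N}$, then $G=_{\mathbb{Im}^\infty}\{\infty\,|\,\overline{\infty}\}$ (the moon) and $\mathrm{mex}(\mathcal{G}(S_G\cup P_G))=\infty$; (ii) if $S_G\cup P_G\neq\mathcal{N}$, then $G=_{\mathbb{Im}^\infty}*\bigl(\mathrm{mex}(\mathcal{G}(S_G\cup P_G))\bigr)$.
   Context: Affine normal play forms are built from terminating games $\infty$ (Left wins) and $\overline{\infty}$ (Right wins), absorbing under disjunctive sum, with $0=\{\overline{\infty}\,|\,\infty\}$. A Left-check is a form with $\infty$ among its Left options; a quiet form is neither $\infty,\overline{\infty}$ nor a check. $G$ is affine impartial ($G\in\mathbb{Im}^\infty$) if $G$ and all its quiet followers are symmetric (Right options are the conjugates of Left options, conjugation swapping players and $\infty\leftrightarrow\overline{\infty}$). Equality modulo $\mathbb{Im}^\infty$ means equal outcomes when added to every $X\in\mathbb{Im}^\infty$. The immediate nimbers $S_G$ are the Left options of $G$ that equal nimbers. The protected nimbers $P_G$ are: all nimbers if $\infty$ is a Left option of $G$; otherwise the set of $*n$ such that some Left option $G^{L}$ of $G$ that is a Left-check satisfies $G^{L}+*n\in\mathscr{L}$. $\mathcal{G}$ maps a set of nimbers $\{*n_i\}$ to $\{n_i\}$, and $\mathrm{mex}$ is the least nonnegative integer not in a set; the Sprague–Grundy value of the moon is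 defined as $\infty$. -}

module Defs where

open import Data.Nat using (ℕ; zero; suc; _<_)
open import Data.List using (List; []; _∷_; _++_)
open import Data.List.Membership.Propositional using (_∈_)
open import Data.List.Relation.Unary.All using (All)
open import Data.List.Relation.Unary.Any using (Any)
open import Data.Product using (Σ; ∃; _×_)
open import Data.Sum using (_⊎_)
open import Data.Empty using (⊥)
open import Data.Unit using (⊤)
open import Relation.Nullary using (¬_)
open import Relation.Binary.PropositionalEquality using (_≡_)

-- Affine normal play forms (finite, short).
-- ∞  : terminating game, Left has won.
-- ∞̄  : terminating game, Right has won.
-- ⟨ Ls ∣ Rs ⟩ : the form with Left options Ls and Right options Rs.

data Form : Set where
  ∞  : Form
  ∞̄  : Form
  ⟨_∣_⟩ : List Form → List Form → Form

leftOpts : Form → List Form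
leftOpts ∞ = []
leftOpts ∞̄ = []
leftOpts ⟨ Ls ∣ _ ⟩ = Ls

rightOpts : Form → List Form
rightOpts ∞ = []
rightOpts ∞̄ = []
rightOpts ⟨ _ ∣ Rs ⟩ = Rs

-- Disjunctive sum.  ∞ and ∞̄ are absorbing.  (The combination ∞ + ∞̄
-- never arises from sums of non-atomic forms; we fix the first
-- summand to win that tie arbitrarily.)

mutual
  infixl 6 _+_
  _+_ : Form → Form → Form
  ∞ + _ = ∞
  ∞̄ + _ = ∞̄
  ⟨ _ ∣ _ ⟩ + ∞ = ∞
  ⟨ _ ∣ _ ⟩ + ∞̄ = ∞̄
  G@(⟨ GL ∣ GR ⟩) + H@(⟨ HL ∣ HR ⟩) =
    ⟨ sumL GL H ++ sumR G HL ∣ sumL GR H ++ sumR G HR ⟩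

  sumL : List Form → Form → List Form
  sumL [] H = []
  sumL (g ∷ gs) H = (g + H) ∷ sumL gs H

  sumR : Form → List Form → List Form
  sumR G [] = []
  sumR G (h ∷ hs) = (G + h) ∷ sumR G hs

mutual
  conj : Form → Form
  conj ∞ = ∞̄
  conj ∞̄ = ∞
  conj ⟨ Ls ∣ Rs ⟩ = ⟨ conjs Rs ∣ conjs Ls ⟩

  conjs : List Form → List Form
  conjs [] = []
  conjs (g ∷ gs) = conj g ∷ conjs gs

LeftCheck : Form → Set
LeftCheck G = ∞ ∈ leftOpts G

RightCheck : Form → Set
RightCheck G = ∞̄ ∈ rightOpts G

Quiet : Form → Set
Quiet ∞ = ⊥
Quiet ∞̄ = ⊥
Quiet G@(⟨ _ ∣ _ ⟩) = ¬ LeftCheck G × ¬ RightCheck G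

Symmetric : Form → Set
Symmetric ∞ = ⊥
Symmetric ∞̄ = ⊥
Symmetric ⟨ Ls ∣ Rs ⟩ =
  (∀ {L} → L ∈ Ls → conj L ∈ Rs) × (∀ {R} → R ∈ Rs → Σ Form λ L → L ∈ Ls × R ≡ conj L)

data Follower : Form → Form → Set where
  self : ∀ {G} → Follower G G
  viaL : ∀ {K H Ls Rs} → H ∈ Ls → Follower K H → Follower K ⟨ Ls ∣ Rs ⟩
  viaR : ∀ {K H Ls Rs} → H ∈ Rs → Follower K H → Follower K ⟨ Ls ∣ Rs ⟩

AffImp : Form → Set
AffImp G = Symmetric G × (∀ K → Follower K G → Quiet K → Symmetric K)

-- Play / outcomes (normal play: a player with no move loses;
-- reaching ∞ means Left has won, ∞̄ means Right has won).

mutual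
  data LFirst : Form → Set where
    lf∞ : LFirst ∞
    lfMove : ∀ {Ls Rs} → Any LSecond Ls → LFirst ⟨ Ls ∣ Rs ⟩

  data LSecond : Form → Set where
    ls∞ : LSecond ∞
    lsAll : ∀ {Ls Rs} → All LFirst Rs → LSecond ⟨ Ls ∣ Rs ⟩

mutual
  data RFirst : Form → Set where
    rf∞̄ : RFirst ∞̄
    rfMove : ∀ {Ls Rs} → Any RSecond Rs → RFirst ⟨ Ls ∣ Rs ⟩

  data RSecond : Form → Set where
    rs∞̄ : RSecond ∞̄
    rsAll : ∀ {Ls Rs} → All RFirst Ls → RSecond ⟨ Ls ∣ Rs ⟩

_⇔_ : Set → Set → Set
A ⇔ B = (A → B) × (B → A)

SameOutcome : Form → Form → Set
SameOutcome G H =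
  (LFirst G ⇔ LFirst H) × (LSecond G ⇔ LSecond H) ×
  (RFirst G ⇔ RFirst H) × (RSecond G ⇔ RSecond H)

InL : Form → Set
InL G = LFirst G × LSecond G

infix 4 _≡Im_
_≡Im_ : Form → Form → Set
G ≡Im H = ∀ X → AffImp X → SameOutcome (G + X) (H + X)

mutual
  nim : ℕ → Form
  nim n = ⟨ nimsBelow n ∣ nimsBelow n ⟩

  nimsBelow : ℕ → List Form
  nimsBelow zero = []
  nimsBelow (suc n) = nim n ∷ nimsBelow n

moon : Form
moon = ⟨ ∞ ∷ [] ∣ ∞̄ ∷ [] ⟩

-- Immediate and protected nimbers, as sets of indices
-- (i.e. already composed with 𝒢 : *n ↦ n).

ImmediateNim : Form → ℕ → Set
ImmediateNim G n = Σ Form λ GL → GL ∈ leftOpts G × GL ≡Im nim n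

-- n ∈ 𝒢(P_G) : ∞ is a Left option of G (then all nimbers are protected),
-- or some Left option that is a Left-check satisfies G^L + *n ∈ 𝓛
ProtectedNim : Form → ℕ → Set
ProtectedNim G n =
  (∞ ∈ leftOpts G) ⊎
  (Σ Form λ GL → GL ∈ leftOpts G × LeftCheck GL × InL (GL + nim n))

SP : Form → ℕ → Set
SP G n = ImmediateNim G n ⊎ ProtectedNim G n

IsMex : (ℕ → Set) → ℕ → Set
IsMex T m = ¬ T m × (∀ k → k < m → T k)

MexIsInfinite : (ℕ → Set) → Set
MexIsInfinite T = ∀ n → T n

-- Every quiet follower of an affine impartial form behaves, in sums, either like a
-- nimber *w or like the moon (Left wins moving first and loses moving second); this is
-- proved by induction on the form.  For a symmetric G whose options behave so, let m be
-- the mex of 𝒢(S_G ∪ P_G).  If m exists, G and *m agree in every context: for each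
-- k < m some Left option of G wins against *k (it equals *k or protects it), no Left
-- option wins against *m, and Right's options are the conjugates of Left's.  If every
-- nimber lies in S_G ∪ P_G, Left wins G + X moving first for each quiet X: either Left
-- wins some *n + X moving second and the option of G accounting for n carries this
-- over, or there is no such n and a protected nimber above all nimber values occurring
-- in G does the same.  By symmetry Right then also wins G + X moving first, exactly as
-- in the moon.

module Submission where

open import Defs
open import Data.Product using (_×_; ∃-syntax; _,_; proj₁; proj₂)
open import Relation.Nullary using (¬_; Dec; yes; no)

open import Data.Nat using (ℕ; zero; suc; _<_; _≟_) renaming (_+_ to _+ℕ_)
open import Data.Nat.Induction using (<-rec)
open import Data.Nat.Properties
  using (<-cmp; <⇒≱; m≤m+n; m≤n+m; <-≤-trans; n<1+n; m<n⇒m<1+n; m<1+n⇒m<n∨m≡n)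
open import Data.List using (List; []; _∷_; _++_)
open import Data.List.Membership.Propositional using (_∈_; lose; find)
open import Data.List.Relation.Binary.Subset.Propositional using (_⊆_)
open import Data.List.Relation.Unary.All as All using (All; []; _∷_)
import Data.List.Relation.Unary.All.Properties as All
open import Data.List.Relation.Unary.Any as Any using (Any; here; there)
import Data.List.Relation.Unary.Any.Properties as Any
open import Data.Sum using (_⊎_; inj₁; inj₂)
open import Data.Empty using (⊥; ⊥-elim)
open import Relation.Nullary.Decidable using (decidable-stable; ¬¬-excluded-middle)
open import Relation.Binary using (tri<; tri≈; tri>)
open import Relation.Binary.PropositionalEquality using (_≡_; _≢_; refl; sym; trans; cong; cong₂; subst)

∈-sumL⁺ : ∀ {L Ls} H → L ∈ Ls → L + H ∈ sumL Ls H
∈-sumL⁺ H (here refl) = here refl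
∈-sumL⁺ H (there m) = there (∈-sumL⁺ H m)

∈-sumL⁻ : ∀ {K} Ls H → K ∈ sumL Ls H → ∃[ L ] L ∈ Ls × K ≡ L + H
∈-sumL⁻ (L ∷ Ls) H (here refl) = L , here refl , refl
∈-sumL⁻ (L ∷ Ls) H (there m) with ∈-sumL⁻ Ls H m
... | L′ , m′ , e = L′ , there m′ , e

∈-sumR⁺ : ∀ {H Hs} G → H ∈ Hs → G + H ∈ sumR G Hs
∈-sumR⁺ G (here refl) = here refl
∈-sumR⁺ G (there m) = there (∈-sumR⁺ G m)

∈-sumR⁻ : ∀ {K} G Hs → K ∈ sumR G Hs → ∃[ H ] H ∈ Hs × K ≡ G + H
∈-sumR⁻ G (H ∷ Hs) (here refl) = H , here refl , refl
∈-sumR⁻ G (H ∷ Hs) (there m) with ∈-sumR⁻ G Hs m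
... | H′ , m′ , e = H′ , there m′ , e

module _ {GL GR XL XR : List Form} where

  LFirst-+ˡ : ∀ {L} → L ∈ GL → LSecond (L + ⟨ XL ∣ XR ⟩) → LFirst (⟨ GL ∣ GR ⟩ + ⟨ XL ∣ XR ⟩)
  LFirst-+ˡ m p = lfMove (Any.++⁺ˡ (lose (∈-sumL⁺ _ m) p))

  LFirst-+ʳ : ∀ {L} → L ∈ XL → LSecond (⟨ GL ∣ GR ⟩ + L) → LFirst (⟨ GL ∣ GR ⟩ + ⟨ XL ∣ XR ⟩)
  LFirst-+ʳ m p = lfMove (Any.++⁺ʳ (sumL GL _) (lose (∈-sumR⁺ _ m) p))

  LFirst-+⁻ : LFirst (⟨ GL ∣ GR ⟩ + ⟨ XL ∣ XR ⟩) →
    (∃[ L ] L ∈ GL × LSecond (L + ⟨ XL ∣ XR ⟩)) ⊎ (∃[ L ] L ∈ XL × LSecond (⟨ GL ∣ GR ⟩ + L))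
  LFirst-+⁻ (lfMove a) with Any.++⁻ (sumL GL _) a
  ... | inj₁ b with find b
  ...   | K , m , p with ∈-sumL⁻ GL _ m
  ...     | L , mL , refl = inj₁ (L , mL , p)
  LFirst-+⁻ (lfMove a) | inj₂ b with find b
  ...   | K , m , p with ∈-sumR⁻ _ XL m
  ...     | L , mL , refl = inj₂ (L , mL , p)

  LSecond-+⁺ : (∀ {R} → R ∈ GR → LFirst (R + ⟨ XL ∣ XR ⟩)) →
    (∀ {R} → R ∈ XR → LFirst (⟨ GL ∣ GR ⟩ + R)) → LSecond (⟨ GL ∣ GR ⟩ + ⟨ XL ∣ XR ⟩)
  LSecond-+⁺ f g = lsAll (All.++⁺ (All.tabulate f′) (All.tabulate g′))
    where
    f′ : ∀ {K} → K ∈ sumL GR ⟨ XL ∣ XR ⟩ → LFirst K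
    f′ m with ∈-sumL⁻ GR _ m
    ... | R , mR , refl = f mR
    g′ : ∀ {K} → K ∈ sumR ⟨ GL ∣ GR ⟩ XR → LFirst K
    g′ m with ∈-sumR⁻ _ XR m
    ... | R , mR , refl = g mR

  LSecond-+⁻ˡ : ∀ {R} → LSecond (⟨ GL ∣ GR ⟩ + ⟨ XL ∣ XR ⟩) → R ∈ GR → LFirst (R + ⟨ XL ∣ XR ⟩)
  LSecond-+⁻ˡ (lsAll a) m = All.lookup (All.++⁻ˡ (sumL GR _) a) (∈-sumL⁺ _ m)

  LSecond-+⁻ʳ : ∀ {R} → LSecond (⟨ GL ∣ GR ⟩ + ⟨ XL ∣ XR ⟩) → R ∈ XR → LFirst (⟨ GL ∣ GR ⟩ + R)
  LSecond-+⁻ʳ (lsAll a) m = All.lookup (All.++⁻ʳ (sumL GR _) a) (∈-sumR⁺ _ m)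

  right-checkˡ-¬LSecond : ∞̄ ∈ GR → ¬ LSecond (⟨ GL ∣ GR ⟩ + ⟨ XL ∣ XR ⟩)
  right-checkˡ-¬LSecond m p with LSecond-+⁻ˡ p m
  ... | ()

  right-checkʳ-¬LSecond : ∞̄ ∈ XR → ¬ LSecond (⟨ GL ∣ GR ⟩ + ⟨ XL ∣ XR ⟩)
  right-checkʳ-¬LSecond m p with LSecond-+⁻ʳ p m
  ... | ()

mutual
  LFirst? : ∀ G → Dec (LFirst G)
  LFirst? ∞ = yes lf∞
  LFirst? ∞̄ = no λ ()
  LFirst? ⟨ Ls ∣ Rs ⟩ with any-LSecond? Ls
  ... | yes a = yes (lfMove a)
  ... | no ¬a = no λ { (lfMove a) → ¬a a }

  any-LSecond? : ∀ Ls → Dec (Any LSecond Ls)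
  any-LSecond? [] = no λ ()
  any-LSecond? (L ∷ Ls) with LSecond? L | any-LSecond? Ls
  ... | yes p | _ = yes (here p)
  ... | no _ | yes a = yes (there a)
  ... | no ¬p | no ¬a = no λ { (here p) → ¬p p ; (there a) → ¬a a }

  LSecond? : ∀ G → Dec (LSecond G)
  LSecond? ∞ = yes ls∞
  LSecond? ∞̄ = no λ ()
  LSecond? ⟨ Ls ∣ Rs ⟩ with all-LFirst? Rs
  ... | yes a = yes (lsAll a)
  ... | no ¬a = no λ { (lsAll a) → ¬a a }

  all-LFirst? : ∀ Rs → Dec (All LFirst Rs)
  all-LFirst? [] = yes []
  all-LFirst? (R ∷ Rs) with LFirst? R | all-LFirst? Rs
  ... | yes p | yes a = yes (p ∷ a)
  ... | no ¬p | _ = no λ { (p ∷ _) → ¬p p }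
  ... | yes _ | no ¬a = no λ { (_ ∷ a) → ¬a a }

mutual
  RFirst⇒¬LSecond : ∀ G → RFirst G → ¬ LSecond G
  RFirst⇒¬LSecond ∞̄ rf∞̄ ()
  RFirst⇒¬LSecond ⟨ Ls ∣ Rs ⟩ (rfMove a) (lsAll b) = Any-RSecond⇒¬All-LFirst a b

  Any-RSecond⇒¬All-LFirst : ∀ {Rs} → Any RSecond Rs → ¬ All LFirst Rs
  Any-RSecond⇒¬All-LFirst {R ∷ _} (here p) (q ∷ _) = RSecond⇒¬LFirst R p q
  Any-RSecond⇒¬All-LFirst (there a) (_ ∷ b) = Any-RSecond⇒¬All-LFirst a b

  RSecond⇒¬LFirst : ∀ G → RSecond G → ¬ LFirst G
  RSecond⇒¬LFirst ∞̄ rs∞̄ ()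
  RSecond⇒¬LFirst ⟨ Ls ∣ Rs ⟩ (rsAll a) (lfMove b) = Any-LSecond⇒¬All-RFirst b a

  Any-LSecond⇒¬All-RFirst : ∀ {Ls} → Any LSecond Ls → ¬ All RFirst Ls
  Any-LSecond⇒¬All-RFirst {L ∷ _} (here p) (q ∷ _) = RFirst⇒¬LSecond L q p
  Any-LSecond⇒¬All-RFirst (there a) (_ ∷ b) = Any-LSecond⇒¬All-RFirst a b

mutual
  ¬LSecond⇒RFirst : ∀ G → ¬ LSecond G → RFirst G
  ¬LSecond⇒RFirst ∞ ¬p = ⊥-elim (¬p ls∞)
  ¬LSecond⇒RFirst ∞̄ _ = rf∞̄
  ¬LSecond⇒RFirst ⟨ Ls ∣ Rs ⟩ ¬p = rfMove (¬All-LFirst⇒Any-RSecond Rs λ a → ¬p (lsAll a))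

  ¬All-LFirst⇒Any-RSecond : ∀ Rs → ¬ All LFirst Rs → Any RSecond Rs
  ¬All-LFirst⇒Any-RSecond [] ¬a = ⊥-elim (¬a [])
  ¬All-LFirst⇒Any-RSecond (R ∷ Rs) ¬a with LFirst? R
  ... | yes p = there (¬All-LFirst⇒Any-RSecond Rs λ a → ¬a (p ∷ a))
  ... | no ¬p = here (¬LFirst⇒RSecond R ¬p)

  ¬LFirst⇒RSecond : ∀ G → ¬ LFirst G → RSecond G
  ¬LFirst⇒RSecond ∞ ¬p = ⊥-elim (¬p lf∞)
  ¬LFirst⇒RSecond ∞̄ _ = rs∞̄
  ¬LFirst⇒RSecond ⟨ Ls ∣ Rs ⟩ ¬p = rsAll (¬Any-LSecond⇒All-RFirst Ls λ a → ¬p (lfMove a))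

  ¬Any-LSecond⇒All-RFirst : ∀ Ls → ¬ Any LSecond Ls → All RFirst Ls
  ¬Any-LSecond⇒All-RFirst [] _ = []
  ¬Any-LSecond⇒All-RFirst (L ∷ Ls) ¬a =
    ¬LSecond⇒RFirst L (λ p → ¬a (here p)) ∷ ¬Any-LSecond⇒All-RFirst Ls (λ a → ¬a (there a))

sameOutcome-fromLeft : ∀ {A B} → (LFirst A ⇔ LFirst B) → (LSecond A ⇔ LSecond B) → SameOutcome A B
sameOutcome-fromLeft {A} {B} (f , f⁻) (s , s⁻) =
  (f , f⁻) , (s , s⁻) ,
  ((λ r → ¬LSecond⇒RFirst B (λ l → RFirst⇒¬LSecond A r (s⁻ l))) ,
   (λ r → ¬LSecond⇒RFirst A (λ l → RFirst⇒¬LSecond B r (s l)))) ,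
  ((λ r → ¬LFirst⇒RSecond B (λ l → RSecond⇒¬LFirst A r (f⁻ l))) ,
   (λ r → ¬LFirst⇒RSecond A (λ l → RSecond⇒¬LFirst B r (f l))))

form-ind : (P : Form → Set) → P ∞ → P ∞̄ →
  (∀ Ls Rs → (∀ {L} → L ∈ Ls → P L) → (∀ {R} → R ∈ Rs → P R) → P ⟨ Ls ∣ Rs ⟩) → ∀ G → P G
form-ind P p∞ p∞̄ step = ind
  where
  mutual
    ind : ∀ G → P G
    ind ∞ = p∞
    ind ∞̄ = p∞̄
    ind ⟨ Ls ∣ Rs ⟩ = step Ls Rs (ind∈ Ls) (ind∈ Rs)

    ind∈ : ∀ Gs {G} → G ∈ Gs → P G
    ind∈ (G ∷ _) (here refl) = ind G
    ind∈ (_ ∷ Gs) (there m) = ind∈ Gs m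

mutual
  conj-involutive : ∀ G → conj (conj G) ≡ G
  conj-involutive ∞ = refl
  conj-involutive ∞̄ = refl
  conj-involutive ⟨ Ls ∣ Rs ⟩ = cong₂ ⟨_∣_⟩ (conjs-involutive Ls) (conjs-involutive Rs)

  conjs-involutive : ∀ Gs → conjs (conjs Gs) ≡ Gs
  conjs-involutive [] = refl
  conjs-involutive (G ∷ Gs) = cong₂ _∷_ (conj-involutive G) (conjs-involutive Gs)

conjs-++ : ∀ Gs Hs → conjs (Gs ++ Hs) ≡ conjs Gs ++ conjs Hs
conjs-++ [] Hs = refl
conjs-++ (G ∷ Gs) Hs = cong (conj G ∷_) (conjs-++ Gs Hs)

mutual
  conj-+ : ∀ G H → conj (G + H) ≡ conj G + conj H
  conj-+ ∞ H = refl
  conj-+ ∞̄ H = refl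
  conj-+ ⟨ GL ∣ GR ⟩ ∞ = refl
  conj-+ ⟨ GL ∣ GR ⟩ ∞̄ = refl
  conj-+ G@(⟨ GL ∣ GR ⟩) H@(⟨ HL ∣ HR ⟩) =
    cong₂ ⟨_∣_⟩
      (trans (conjs-++ (sumL GR H) (sumR G HR)) (cong₂ _++_ (conjs-sumL GR H) (conjs-sumR G HR)))
      (trans (conjs-++ (sumL GL H) (sumR G HL)) (cong₂ _++_ (conjs-sumL GL H) (conjs-sumR G HL)))

  conjs-sumL : ∀ Gs H → conjs (sumL Gs H) ≡ sumL (conjs Gs) (conj H)
  conjs-sumL [] H = refl
  conjs-sumL (G ∷ Gs) H = cong₂ _∷_ (conj-+ G H) (conjs-sumL Gs H)

  conjs-sumR : ∀ G Hs → conjs (sumR G Hs) ≡ sumR (conj G) (conjs Hs)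
  conjs-sumR G [] = refl
  conjs-sumR G (H ∷ Hs) = cong₂ _∷_ (conj-+ G H) (conjs-sumR G Hs)

conj-+-conj : ∀ G H → conj (conj G + conj H) ≡ G + H
conj-+-conj G H = trans (conj-+ (conj G) (conj H)) (cong₂ _+_ (conj-involutive G) (conj-involutive H))

mutual
  LFirst⇒RFirst-conj : ∀ G → LFirst G → RFirst (conj G)
  LFirst⇒RFirst-conj ∞ lf∞ = rf∞̄
  LFirst⇒RFirst-conj ⟨ Ls ∣ Rs ⟩ (lfMove a) = rfMove (Any-LSecond⇒Any-RSecond-conjs a)

  Any-LSecond⇒Any-RSecond-conjs : ∀ {Ls} → Any LSecond Ls → Any RSecond (conjs Ls)
  Any-LSecond⇒Any-RSecond-conjs {L ∷ _} (here p) = here (LSecond⇒RSecond-conj L p)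
  Any-LSecond⇒Any-RSecond-conjs (there a) = there (Any-LSecond⇒Any-RSecond-conjs a)

  LSecond⇒RSecond-conj : ∀ G → LSecond G → RSecond (conj G)
  LSecond⇒RSecond-conj ∞ ls∞ = rs∞̄
  LSecond⇒RSecond-conj ⟨ Ls ∣ Rs ⟩ (lsAll a) = rsAll (All-LFirst⇒All-RFirst-conjs a)

  All-LFirst⇒All-RFirst-conjs : ∀ {Rs} → All LFirst Rs → All RFirst (conjs Rs)
  All-LFirst⇒All-RFirst-conjs {[]} [] = []
  All-LFirst⇒All-RFirst-conjs {R ∷ _} (p ∷ a) = LFirst⇒RFirst-conj R p ∷ All-LFirst⇒All-RFirst-conjs a

mutual
  RFirst⇒LFirst-conj : ∀ G → RFirst G → LFirst (conj G)
  RFirst⇒LFirst-conj ∞̄ rf∞̄ = lf∞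
  RFirst⇒LFirst-conj ⟨ Ls ∣ Rs ⟩ (rfMove a) = lfMove (Any-RSecond⇒Any-LSecond-conjs a)

  Any-RSecond⇒Any-LSecond-conjs : ∀ {Rs} → Any RSecond Rs → Any LSecond (conjs Rs)
  Any-RSecond⇒Any-LSecond-conjs {R ∷ _} (here p) = here (RSecond⇒LSecond-conj R p)
  Any-RSecond⇒Any-LSecond-conjs (there a) = there (Any-RSecond⇒Any-LSecond-conjs a)

  RSecond⇒LSecond-conj : ∀ G → RSecond G → LSecond (conj G)
  RSecond⇒LSecond-conj ∞̄ rs∞̄ = ls∞
  RSecond⇒LSecond-conj ⟨ Ls ∣ Rs ⟩ (rsAll a) = lsAll (All-RFirst⇒All-LFirst-conjs a)

  All-RFirst⇒All-LFirst-conjs : ∀ {Ls} → All RFirst Ls → All LFirst (conjs Ls)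
  All-RFirst⇒All-LFirst-conjs {[]} [] = []
  All-RFirst⇒All-LFirst-conjs {L ∷ _} (p ∷ a) = RFirst⇒LFirst-conj L p ∷ All-RFirst⇒All-LFirst-conjs a

∈-conjs⁺ : ∀ {G Gs} → G ∈ Gs → conj G ∈ conjs Gs
∈-conjs⁺ (here refl) = here refl
∈-conjs⁺ (there m) = there (∈-conjs⁺ m)

∈-conjs⁻ : ∀ {H} Gs → H ∈ conjs Gs → ∃[ G ] G ∈ Gs × H ≡ conj G
∈-conjs⁻ (G ∷ Gs) (here refl) = G , here refl , refl
∈-conjs⁻ (G ∷ Gs) (there m) with ∈-conjs⁻ Gs m
... | G′ , m′ , e = G′ , there m′ , e

infix 4 _⊑_

record _⊑_ (A B : Form) : Set where
  field
    first  : LFirst A → LFirst B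
    second : LSecond A → LSecond B

open _⊑_ public

⊑-refl : ∀ {A} → A ⊑ A
⊑-refl = record { first = λ p → p ; second = λ p → p }

options-monoˡ : ∀ {AL AR AL′ AR′} → AL ⊆ AL′ → AR′ ⊆ AR → ∀ Y → ⟨ AL ∣ AR ⟩ + Y ⊑ ⟨ AL′ ∣ AR′ ⟩ + Y
options-monoˡ {AL} {AR} {AL′} {AR′} L⊆ R⊇ = form-ind Improves ⊑-refl ⊑-refl step
  where
  Improves : Form → Set
  Improves Y = ⟨ AL ∣ AR ⟩ + Y ⊑ ⟨ AL′ ∣ AR′ ⟩ + Y
  step : ∀ YL YR → (∀ {L} → L ∈ YL → Improves L) → (∀ {R} → R ∈ YR → Improves R) → Improves ⟨ YL ∣ YR ⟩
  step YL YR ihL ihR = record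
    { first = λ p → from-move (LFirst-+⁻ p)
    ; second = λ p → LSecond-+⁺ (λ m → LSecond-+⁻ˡ p (R⊇ m)) (λ m → first (ihR m) (LSecond-+⁻ʳ p m))
    }
    where
    from-move : (∃[ L ] L ∈ AL × LSecond (L + ⟨ YL ∣ YR ⟩)) ⊎ (∃[ L ] L ∈ YL × LSecond (⟨ AL ∣ AR ⟩ + L)) →
      LFirst (⟨ AL′ ∣ AR′ ⟩ + ⟨ YL ∣ YR ⟩)
    from-move (inj₁ (L , m , q)) = LFirst-+ˡ (L⊆ m) q
    from-move (inj₂ (L , m , q)) = LFirst-+ʳ m (second (ihL m) q)

options-monoʳ : ∀ {BL BR BL′ BR′} → BL ⊆ BL′ → BR′ ⊆ BR → ∀ Z → Z + ⟨ BL ∣ BR ⟩ ⊑ Z + ⟨ BL′ ∣ BR′ ⟩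
options-monoʳ {BL} {BR} {BL′} {BR′} L⊆ R⊇ = form-ind Improves ⊑-refl ⊑-refl step
  where
  Improves : Form → Set
  Improves Z = Z + ⟨ BL ∣ BR ⟩ ⊑ Z + ⟨ BL′ ∣ BR′ ⟩
  step : ∀ ZL ZR → (∀ {L} → L ∈ ZL → Improves L) → (∀ {R} → R ∈ ZR → Improves R) → Improves ⟨ ZL ∣ ZR ⟩
  step ZL ZR ihL ihR = record
    { first = λ p → from-move (LFirst-+⁻ p)
    ; second = λ p → LSecond-+⁺ (λ m → first (ihR m) (LSecond-+⁻ˡ p m)) (λ m → LSecond-+⁻ʳ p (R⊇ m))
    }
    where
    from-move : (∃[ L ] L ∈ ZL × LSecond (L + ⟨ BL ∣ BR ⟩)) ⊎ (∃[ L ] L ∈ BL × LSecond (⟨ ZL ∣ ZR ⟩ + L)) →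
      LFirst (⟨ ZL ∣ ZR ⟩ + ⟨ BL′ ∣ BR′ ⟩)
    from-move (inj₁ (L , m , q)) = LFirst-+ˡ m (second (ihL m) q)
    from-move (inj₂ (L , m , q)) = LFirst-+ʳ (L⊆ m) q

module SymmetricOptions {GL GR : List Form} (sy : Symmetric ⟨ GL ∣ GR ⟩) where

  conjs-right⊆left : conjs GR ⊆ GL
  conjs-right⊆left m with ∈-conjs⁻ GR m
  ... | R , mR , refl with proj₂ sy mR
  ...   | L , mL , refl = subst (_∈ GL) (sym (conj-involutive L)) mL

  left⊆conjs-right : GL ⊆ conjs GR
  left⊆conjs-right {L} m = subst (_∈ conjs GR) (conj-involutive L) (∈-conjs⁺ (proj₁ sy m))

  conjs-left⊆right : conjs GL ⊆ GR
  conjs-left⊆right m with ∈-conjs⁻ GL m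
  ... | L , mL , refl = proj₁ sy mL

  right⊆conjs-left : GR ⊆ conjs GL
  right⊆conjs-left m with proj₂ sy m
  ... | L , mL , refl = ∈-conjs⁺ mL

module _ {GL GR XL XR : List Form} (syG : Symmetric ⟨ GL ∣ GR ⟩) (syX : Symmetric ⟨ XL ∣ XR ⟩) where
  private
    module SG = SymmetricOptions syG
    module SX = SymmetricOptions syX

  symmetric-LFirst⇒RFirst : LFirst (⟨ GL ∣ GR ⟩ + ⟨ XL ∣ XR ⟩) → RFirst (⟨ GL ∣ GR ⟩ + ⟨ XL ∣ XR ⟩)
  symmetric-LFirst⇒RFirst p =
    subst RFirst (conj-+-conj ⟨ GL ∣ GR ⟩ ⟨ XL ∣ XR ⟩) (LFirst⇒RFirst-conj _
      (first (options-monoʳ SX.left⊆conjs-right SX.conjs-left⊆right (conj ⟨ GL ∣ GR ⟩))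
        (first (options-monoˡ SG.left⊆conjs-right SG.conjs-left⊆right ⟨ XL ∣ XR ⟩) p)))

  symmetric-RFirst⇒LFirst : RFirst (⟨ GL ∣ GR ⟩ + ⟨ XL ∣ XR ⟩) → LFirst (⟨ GL ∣ GR ⟩ + ⟨ XL ∣ XR ⟩)
  symmetric-RFirst⇒LFirst p =
    first (options-monoʳ SX.conjs-right⊆left SX.right⊆conjs-left ⟨ GL ∣ GR ⟩)
      (first (options-monoˡ SG.conjs-right⊆left SG.right⊆conjs-left (conj ⟨ XL ∣ XR ⟩))
        (subst LFirst (conj-+ ⟨ GL ∣ GR ⟩ _) (RFirst⇒LFirst-conj (⟨ GL ∣ GR ⟩ + ⟨ XL ∣ XR ⟩) p)))

∈-nimsBelow⁻ : ∀ {R} n → R ∈ nimsBelow n → ∃[ k ] k < n × R ≡ nim k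
∈-nimsBelow⁻ (suc n) (here refl) = n , n<1+n n , refl
∈-nimsBelow⁻ (suc n) (there m) with ∈-nimsBelow⁻ n m
... | k , k<n , e = k , m<n⇒m<1+n k<n , e

∈-nimsBelow⁺ : ∀ {k n} → k < n → nim k ∈ nimsBelow n
∈-nimsBelow⁺ {n = suc n} k<1+n with m<1+n⇒m<n∨m≡n k<1+n
... | inj₁ k<n = there (∈-nimsBelow⁺ k<n)
... | inj₂ refl = here refl

mutual
  conj-nim : ∀ n → conj (nim n) ≡ nim n
  conj-nim n = cong₂ ⟨_∣_⟩ (conjs-nimsBelow n) (conjs-nimsBelow n)

  conjs-nimsBelow : ∀ n → conjs (nimsBelow n) ≡ nimsBelow n
  conjs-nimsBelow zero = refl
  conjs-nimsBelow (suc n) = cong₂ _∷_ (conj-nim n) (conjs-nimsBelow n)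

-- Tweedledum: Left answers every move by the mirrored move in the other summand.
LSecond-nim+nim-self : ∀ n → LSecond (nim n + nim n)
LSecond-nim+nim-self = <-rec (λ n → LSecond (nim n + nim n)) mirror
  where
  mirror : ∀ n → (∀ {k} → k < n → LSecond (nim k + nim k)) → LSecond (nim n + nim n)
  mirror n ih = LSecond-+⁺ answerˡ answerʳ
    where
    answerˡ : ∀ {R} → R ∈ nimsBelow n → LFirst (R + nim n)
    answerˡ m with ∈-nimsBelow⁻ n m
    ... | k , k<n , refl = LFirst-+ʳ (∈-nimsBelow⁺ k<n) (ih k<n)
    answerʳ : ∀ {R} → R ∈ nimsBelow n → LFirst (nim n + R)
    answerʳ m with ∈-nimsBelow⁻ n m
    ... | k , k<n , refl = LFirst-+ˡ (∈-nimsBelow⁺ k<n) (ih k<n)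

RSecond-nim+nim-self : ∀ n → RSecond (nim n + nim n)
RSecond-nim+nim-self n =
  subst RSecond (trans (conj-+ (nim n) (nim n)) (cong₂ _+_ (conj-nim n) (conj-nim n)))
    (LSecond⇒RSecond-conj (nim n + nim n) (LSecond-nim+nim-self n))

LSecond-nim+nim⇒≡ : ∀ {a b} → LSecond (nim a + nim b) → a ≡ b
LSecond-nim+nim⇒≡ {a} {b} p with <-cmp a b
... | tri≈ _ a≡b _ = a≡b
... | tri< a<b _ _ = ⊥-elim (RSecond⇒¬LFirst _ (RSecond-nim+nim-self a) (LSecond-+⁻ʳ p (∈-nimsBelow⁺ a<b)))
... | tri> _ _ b<a = ⊥-elim (RSecond⇒¬LFirst _ (RSecond-nim+nim-self b) (LSecond-+⁻ˡ p (∈-nimsBelow⁺ b<a)))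

LFirst-nim+nim⇒≢ : ∀ {a b} → LFirst (nim a + nim b) → a ≢ b
LFirst-nim+nim⇒≢ {a} p refl = RSecond⇒¬LFirst _ (RSecond-nim+nim-self a) p

≢⇒LFirst-nim+nim : ∀ {a b} → a ≢ b → LFirst (nim a + nim b)
≢⇒LFirst-nim+nim {a} {b} a≢b with <-cmp a b
... | tri≈ _ a≡b _ = ⊥-elim (a≢b a≡b)
... | tri< a<b _ _ = LFirst-+ʳ (∈-nimsBelow⁺ a<b) (LSecond-nim+nim-self a)
... | tri> _ _ b<a = LFirst-+ˡ (∈-nimsBelow⁺ b<a) (LSecond-nim+nim-self b)

conj-+-nim : ∀ L k → conj (L + nim k) ≡ conj L + nim k
conj-+-nim L k = trans (conj-+ L (nim k)) (cong (conj L +_) (conj-nim k))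

LSecond⇒¬LFirst-conj+nim : ∀ {L k} → LSecond (L + nim k) → ¬ LFirst (conj L + nim k)
LSecond⇒¬LFirst-conj+nim {L} {k} p =
  RSecond⇒¬LFirst _ (subst RSecond (conj-+-nim L k) (LSecond⇒RSecond-conj (L + nim k) p))

¬LSecond⇒LFirst-conj+nim : ∀ {L k} → ¬ LSecond (L + nim k) → LFirst (conj L + nim k)
¬LSecond⇒LFirst-conj+nim {L} {k} ¬p =
  subst LFirst (conj-+-nim L k) (RFirst⇒LFirst-conj (L + nim k) (¬LSecond⇒RFirst (L + nim k) ¬p))

nim-follower : ∀ {K} n → Follower K (nim n) → ∃[ k ] K ≡ nim k
nim-follower n self = n , refl
nim-follower n (viaL m f) with ∈-nimsBelow⁻ n m
... | k , _ , refl = nim-follower k f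
nim-follower n (viaR m f) with ∈-nimsBelow⁻ n m
... | k , _ , refl = nim-follower k f

nim-symmetric : ∀ n → Symmetric (nim n)
nim-symmetric n = conj∈ , ∈conj
  where
  conj∈ : ∀ {L} → L ∈ nimsBelow n → conj L ∈ nimsBelow n
  conj∈ m with ∈-nimsBelow⁻ n m
  ... | k , k<n , refl = subst (_∈ nimsBelow n) (sym (conj-nim k)) (∈-nimsBelow⁺ k<n)
  ∈conj : ∀ {R} → R ∈ nimsBelow n → ∃[ L ] L ∈ nimsBelow n × R ≡ conj L
  ∈conj m with ∈-nimsBelow⁻ n m
  ... | k , k<n , refl = nim k , ∈-nimsBelow⁺ k<n , sym (conj-nim k)

nim-affImp : ∀ n → AffImp (nim n)
nim-affImp n = nim-symmetric n , λ K f _ → symmetric-follower (nim-follower n f)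
  where
  symmetric-follower : ∀ {K} → ∃[ k ] K ≡ nim k → Symmetric K
  symmetric-follower (k , refl) = nim-symmetric k

QuietFollowers : (Form → Set) → Form → Set
QuietFollowers P G = ∀ K → Follower K G → Quiet K → P K

QuietFollowers-left : ∀ {P Ls Rs L} → QuietFollowers P ⟨ Ls ∣ Rs ⟩ → L ∈ Ls → QuietFollowers P L
QuietFollowers-left h m K f = h K (viaL m f)

QuietFollowers-right : ∀ {P Ls Rs R} → QuietFollowers P ⟨ Ls ∣ Rs ⟩ → R ∈ Rs → QuietFollowers P R
QuietFollowers-right h m K f = h K (viaR m f)

-- AffImp G unfolds to Symmetric G × WeaklyImpartial G; only the second factor is
-- inherited by options that are checks.
WeaklyImpartial : Form → Set
WeaklyImpartial = QuietFollowers Symmetric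

quiet-weaklyImpartial⇒affImp : ∀ {X} → WeaklyImpartial X → Quiet X → AffImp X
quiet-weaklyImpartial⇒affImp w q = w _ self q , w

nim-weaklyImpartial : ∀ n → WeaklyImpartial (nim n)
nim-weaklyImpartial n = proj₂ (nim-affImp n)

data Shape (Ls Rs : List Form) : Set where
  left-check  : ∞ ∈ Ls → Shape Ls Rs
  right-check : ∞̄ ∈ Rs → Shape Ls Rs
  quiet       : Quiet ⟨ Ls ∣ Rs ⟩ → Shape Ls Rs

∞≟_ : ∀ G → Dec (∞ ≡ G)
∞≟ ∞ = yes refl
∞≟ ∞̄ = no λ ()
∞≟ ⟨ _ ∣ _ ⟩ = no λ ()

∞̄≟_ : ∀ G → Dec (∞̄ ≡ G)
∞̄≟ ∞ = no λ ()
∞̄≟ ∞̄ = yes refl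
∞̄≟ ⟨ _ ∣ _ ⟩ = no λ ()

shape : ∀ Ls Rs → Shape Ls Rs
shape Ls Rs with Any.any? ∞≟_ Ls | Any.any? ∞̄≟_ Rs
... | yes lc | _ = left-check lc
... | no _ | yes rc = right-check rc
... | no ¬lc | no ¬rc = quiet (¬lc , ¬rc)

∞∉nimsBelow : ∀ n → ¬ ∞ ∈ nimsBelow n
∞∉nimsBelow n m with ∈-nimsBelow⁻ n m
... | _ , _ , ()

∞̄∉nimsBelow : ∀ n → ¬ ∞̄ ∈ nimsBelow n
∞̄∉nimsBelow n m with ∈-nimsBelow⁻ n m
... | _ , _ , ()

-- Contexts with a check are handled by induction alone, once the hypotheses exclude the
-- checks of A and B that would interfere; only quiet contexts need an argument.
⊑-in-contexts : ∀ {AL AR BL BR} → ¬ ∞ ∈ AL → ¬ ∞̄ ∈ BR → (V : Form → Set) →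
  (∀ {YL YR} → V ⟨ YL ∣ YR ⟩ → ⟨ YL ∣ YR ⟩ + ⟨ AL ∣ AR ⟩ ⊑ ⟨ YL ∣ YR ⟩ + ⟨ BL ∣ BR ⟩) →
  ∀ Y → QuietFollowers V Y → Y + ⟨ AL ∣ AR ⟩ ⊑ Y + ⟨ BL ∣ BR ⟩
⊑-in-contexts {AL} {AR} {BL} {BR} ∞∉AL ∞̄∉BR V quiet-case =
  form-ind Comparable (λ _ → ⊑-refl) (λ _ → ⊑-refl) step
  where
  Comparable : Form → Set
  Comparable Y = QuietFollowers V Y → Y + ⟨ AL ∣ AR ⟩ ⊑ Y + ⟨ BL ∣ BR ⟩
  step : ∀ YL YR → (∀ {L} → L ∈ YL → Comparable L) → (∀ {R} → R ∈ YR → Comparable R) → Comparable ⟨ YL ∣ YR ⟩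
  step YL YR ihL ihR vY with shape YL YR
  ... | quiet q = quiet-case (vY _ self q)
  ... | left-check lc = record
    { first = λ _ → LFirst-+ˡ lc ls∞
    ; second = λ p → LSecond-+⁺ (λ m → first (ihR m (QuietFollowers-right vY m)) (LSecond-+⁻ˡ p m)) answer
    }
    where
    answer : ∀ {R} → R ∈ BR → LFirst (⟨ YL ∣ YR ⟩ + R)
    answer {∞} _ = lf∞
    answer {∞̄} m = ⊥-elim (∞̄∉BR m)
    answer {⟨ _ ∣ _ ⟩} _ = LFirst-+ˡ lc ls∞
  ... | right-check rc = record
    { first = λ p → from-move (LFirst-+⁻ p)
    ; second = λ p → ⊥-elim (right-checkˡ-¬LSecond rc p)
    }
    where
    from-move : (∃[ L ] L ∈ YL × LSecond (L + ⟨ AL ∣ AR ⟩)) ⊎ (∃[ L ] L ∈ AL × LSecond (⟨ YL ∣ YR ⟩ + L)) →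
      LFirst (⟨ YL ∣ YR ⟩ + ⟨ BL ∣ BR ⟩)
    from-move (inj₁ (L , m , q)) = LFirst-+ˡ m (second (ihL m (QuietFollowers-left vY m)) q)
    from-move (inj₂ (∞ , m , _)) = ⊥-elim (∞∉AL m)
    from-move (inj₂ (∞̄ , _ , ()))
    from-move (inj₂ (⟨ _ ∣ _ ⟩ , _ , q)) = ⊥-elim (right-checkˡ-¬LSecond rc q)

infix 4 _≈ᴸ_

record _≈ᴸ_ (A B : Form) : Set where
  field
    to   : A ⊑ B
    from : B ⊑ A

open _≈ᴸ_ public

≈ᴸ-refl : ∀ {A} → A ≈ᴸ A
≈ᴸ-refl = record { to = ⊑-refl ; from = ⊑-refl }

-- Tested against all weakly impartial Y, not only affine impartial ones, so that it
-- can be used for the options of Y, which may be checks.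
NimLike : Form → ℕ → Set
NimLike K w = ∀ Y → WeaklyImpartial Y → K + Y ≈ᴸ nim w + Y

MoonLike : Form → Set
MoonLike K = ∀ Y → AffImp Y → LFirst (K + Y) × ¬ LSecond (K + Y)

nimLike⇒≡Im : ∀ {K w} → NimLike K w → K ≡Im nim w
nimLike⇒≡Im nl X (_ , wX) = sameOutcome-fromLeft
  (first (to (nl X wX)) , first (from (nl X wX)))
  (second (to (nl X wX)) , second (from (nl X wX)))

-- SP is not decidable, so the dichotomy is only available under double negation.
Valued : Form → Set
Valued K = ¬ ¬ (∃[ w ] NimLike K w ⊎ MoonLike K)

Valued-elim : ∀ {K} {P : Set} → Dec P → Valued K → (∀ w → NimLike K w → P) → (MoonLike K → P) → P
Valued-elim P? v nim-case moon-case = decidable-stable P? λ ¬p → v λ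
  { (inj₁ (w , nl)) → ¬p (nim-case w nl)
  ; (inj₂ ml) → ¬p (moon-case ml)
  }

valued-+-⊑-nim : ∀ {XL XR YL YR k} → WeaklyImpartial ⟨ XL ∣ XR ⟩ → ¬ LFirst (nim k + ⟨ XL ∣ XR ⟩) →
  Valued ⟨ YL ∣ YR ⟩ → ⟨ YL ∣ YR ⟩ + ⟨ XL ∣ XR ⟩ ⊑ ⟨ YL ∣ YR ⟩ + nim k
valued-+-⊑-nim {XL} {XR} {YL} {YR} {k} wX ¬lf v = record { first = lf ; second = ls }
  where
  X Y : Form
  X = ⟨ XL ∣ XR ⟩
  Y = ⟨ YL ∣ YR ⟩
  lf : LFirst (Y + X) → LFirst (Y + nim k)
  lf p = Valued-elim (LFirst? (Y + nim k)) v nim-case moon-case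
    where
    nim-case : ∀ w → NimLike Y w → LFirst (Y + nim k)
    nim-case w nl with w ≟ k
    ... | yes refl = ⊥-elim (¬lf (first (to (nl X wX)) p))
    ... | no w≢k = first (from (nl (nim k) (nim-weaklyImpartial k))) (≢⇒LFirst-nim+nim w≢k)
    moon-case : MoonLike Y → LFirst (Y + nim k)
    moon-case ml = proj₁ (ml (nim k) (nim-affImp k))
  ls : LSecond (Y + X) → LSecond (Y + nim k)
  ls p = Valued-elim (LSecond? (Y + nim k)) v nim-case moon-case
    where
    nim-case : ∀ w → NimLike Y w → LSecond (Y + nim k)
    nim-case w nl with <-cmp w k
    ... | tri< w<k _ _ = ⊥-elim (¬lf (LFirst-+ˡ (∈-nimsBelow⁺ w<k) (second (to (nl X wX)) p)))
    ... | tri> _ _ k<w = ⊥-elim (¬lf (LSecond-+⁻ˡ (second (to (nl X wX)) p) (∈-nimsBelow⁺ k<w)))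
    ... | tri≈ _ refl _ = second (from (nl (nim k) (nim-weaklyImpartial k))) (LSecond-nim+nim-self k)
    moon-case : MoonLike Y → LSecond (Y + nim k)
    moon-case ml with shape XL XR
    ... | left-check m = ⊥-elim (¬lf (LFirst-+ʳ m ls∞))
    ... | right-check m = ⊥-elim (right-checkʳ-¬LSecond m p)
    ... | quiet q = ⊥-elim (proj₂ (ml X (quiet-weaklyImpartial⇒affImp wX q)) p)

valued-+-nim-⊑ : ∀ {XL XR YL YR k} → WeaklyImpartial ⟨ XL ∣ XR ⟩ → LSecond (nim k + ⟨ XL ∣ XR ⟩) →
  Valued ⟨ YL ∣ YR ⟩ → ⟨ YL ∣ YR ⟩ + nim k ⊑ ⟨ YL ∣ YR ⟩ + ⟨ XL ∣ XR ⟩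
valued-+-nim-⊑ {XL} {XR} {YL} {YR} {k} wX ls v = record { first = lf ; second = lsY }
  where
  X Y : Form
  X = ⟨ XL ∣ XR ⟩
  Y = ⟨ YL ∣ YR ⟩
  lf : LFirst (Y + nim k) → LFirst (Y + X)
  lf p = Valued-elim (LFirst? (Y + X)) v nim-case moon-case
    where
    nim-case : ∀ w → NimLike Y w → LFirst (Y + X)
    nim-case w nl with <-cmp w k
    ... | tri< w<k _ _ = first (from (nl X wX)) (LSecond-+⁻ˡ ls (∈-nimsBelow⁺ w<k))
    ... | tri> _ _ k<w = first (from (nl X wX)) (LFirst-+ˡ (∈-nimsBelow⁺ k<w) ls)
    ... | tri≈ _ refl _ = ⊥-elim (LFirst-nim+nim⇒≢ {w} (first (to (nl (nim k) (nim-weaklyImpartial k))) p) refl)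
    moon-case : MoonLike Y → LFirst (Y + X)
    moon-case ml with shape XL XR
    ... | left-check m = LFirst-+ʳ m ls∞
    ... | right-check m = ⊥-elim (right-checkʳ-¬LSecond m ls)
    ... | quiet q = proj₁ (ml X (quiet-weaklyImpartial⇒affImp wX q))
  lsY : LSecond (Y + nim k) → LSecond (Y + X)
  lsY p = Valued-elim (LSecond? (Y + X)) v nim-case moon-case
    where
    nim-case : ∀ w → NimLike Y w → LSecond (Y + X)
    nim-case w nl with LSecond-nim+nim⇒≡ {w} {k} (second (to (nl (nim k) (nim-weaklyImpartial k))) p)
    ... | refl = second (from (nl X wX)) ls
    moon-case : MoonLike Y → LSecond (Y + X)
    moon-case ml = ⊥-elim (proj₂ (ml (nim k) (nim-affImp k)) p)

⊑-nim-in-contexts : ∀ {XL XR} k → WeaklyImpartial ⟨ XL ∣ XR ⟩ → ¬ LFirst (nim k + ⟨ XL ∣ XR ⟩) →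
  ∀ Y → QuietFollowers Valued Y → Y + ⟨ XL ∣ XR ⟩ ⊑ Y + nim k
⊑-nim-in-contexts k wX ¬lf =
  ⊑-in-contexts (λ m → ¬lf (LFirst-+ʳ m ls∞)) (∞̄∉nimsBelow k) Valued (valued-+-⊑-nim wX ¬lf)

nim-⊑-in-contexts : ∀ {XL XR} k → WeaklyImpartial ⟨ XL ∣ XR ⟩ → LSecond (nim k + ⟨ XL ∣ XR ⟩) →
  ∀ Y → QuietFollowers Valued Y → Y + nim k ⊑ Y + ⟨ XL ∣ XR ⟩
nim-⊑-in-contexts k wX ls =
  ⊑-in-contexts (∞∉nimsBelow k) (λ m → right-checkʳ-¬LSecond m ls) Valued (valued-+-nim-⊑ wX ls)

module Mex {GL GR : List Form} (sy : Symmetric ⟨ GL ∣ GR ⟩)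
  (vL : ∀ {L} → L ∈ GL → QuietFollowers Valued L) (vR : ∀ {R} → R ∈ GR → QuietFollowers Valued R)
  {m : ℕ} (mex : IsMex (SP ⟨ GL ∣ GR ⟩) m) where

  G : Form
  G = ⟨ GL ∣ GR ⟩

  option+mex-¬LSecond : ∀ {L} → L ∈ GL → ¬ LSecond (L + nim m)
  option+mex-¬LSecond {∞} mL _ = proj₁ mex (inj₂ (inj₁ mL))
  option+mex-¬LSecond {⟨ LL ∣ LR ⟩} mL p with shape LL LR
  ... | left-check lc = proj₁ mex (inj₂ (inj₂ (⟨ LL ∣ LR ⟩ , mL , lc , LFirst-+ˡ lc ls∞ , p)))
  ... | right-check rc = right-checkˡ-¬LSecond rc p
  ... | quiet q = Valued-elim (no λ ()) (vL mL _ self q) nim-case moon-case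
    where
    nim-case : ∀ w → NimLike ⟨ LL ∣ LR ⟩ w → ⊥
    nim-case w nl with LSecond-nim+nim⇒≡ {w} {m} (second (to (nl (nim m) (nim-weaklyImpartial m))) p)
    ... | refl = proj₁ mex (inj₁ (⟨ LL ∣ LR ⟩ , mL , nimLike⇒≡Im nl))
    moon-case : MoonLike ⟨ LL ∣ LR ⟩ → ⊥
    moon-case ml = proj₂ (ml (nim m) (nim-affImp m)) p

  option+below-mex-LSecond : ∀ {k} → k < m → ∃[ L ] L ∈ GL × LSecond (L + nim k)
  option+below-mex-LSecond {k} k<m with proj₂ mex k k<m
  ... | inj₁ (L , mL , L≡*k) =
    L , mL , proj₂ (proj₁ (proj₂ (L≡*k (nim k) (nim-affImp k)))) (LSecond-nim+nim-self k)
  ... | inj₂ (inj₁ ∞∈GL) = ⊥-elim (proj₁ mex (inj₂ (inj₁ ∞∈GL)))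
  ... | inj₂ (inj₂ (L , mL , _ , (_ , p))) = L , mL , p

  Equivalent : Form → Set
  Equivalent X = G + X ≈ᴸ nim m + X

  module _ {XL XR : List Form} (wX : WeaklyImpartial ⟨ XL ∣ XR ⟩)
    (ihL : ∀ {L} → L ∈ XL → Equivalent L) (ihR : ∀ {R} → R ∈ XR → Equivalent R) where

    X : Form
    X = ⟨ XL ∣ XR ⟩

    G⊑mex : G + X ⊑ nim m + X
    G⊑mex = record { first = lf ; second = ls }
      where
      lf : LFirst (G + X) → LFirst (nim m + X)
      lf p with LFirst-+⁻ p
      ... | inj₁ (L , mL , q) = decidable-stable (LFirst? (nim m + X)) λ ¬lf →
        option+mex-¬LSecond mL (second (⊑-nim-in-contexts m wX ¬lf L (vL mL)) q)
      ... | inj₂ (L , mL , q) = LFirst-+ʳ mL (second (to (ihL mL)) q)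
      -- Right's move to *k + X is mirrored in G + X by the conjugate of a Left option
      -- of G that wins against *k.
      ls : LSecond (G + X) → LSecond (nim m + X)
      ls p = LSecond-+⁺ answer (λ mR → first (to (ihR mR)) (LSecond-+⁻ʳ p mR))
        where
        answer : ∀ {R} → R ∈ nimsBelow m → LFirst (R + X)
        answer mR with ∈-nimsBelow⁻ m mR
        ... | k , k<m , refl with option+below-mex-LSecond k<m
        ... | L , mL , q = decidable-stable (LFirst? (nim k + X)) λ ¬lf →
          LSecond⇒¬LFirst-conj+nim q
            (first (⊑-nim-in-contexts k wX ¬lf (conj L) (vR (proj₁ sy mL))) (LSecond-+⁻ˡ p (proj₁ sy mL)))

    mex⊑G : nim m + X ⊑ G + X
    mex⊑G = record { first = lf ; second = ls }
      where
      lf : LFirst (nim m + X) → LFirst (G + X)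
      lf p with LFirst-+⁻ p
      ... | inj₂ (L , mL , q) = LFirst-+ʳ mL (second (from (ihL mL)) q)
      ... | inj₁ (R , mR , q) with ∈-nimsBelow⁻ m mR
      ... | k , k<m , refl with option+below-mex-LSecond k<m
      ... | L , mL , r = LFirst-+ˡ mL (second (nim-⊑-in-contexts k wX q L (vL mL)) r)
      ls : LSecond (nim m + X) → LSecond (G + X)
      ls p = LSecond-+⁺ answer (λ mR → first (from (ihR mR)) (LSecond-+⁻ʳ p mR))
        where
        answer : ∀ {R} → R ∈ GR → LFirst (R + X)
        answer mR with proj₂ sy mR
        ... | L , mL , refl =
          first (nim-⊑-in-contexts m wX p (conj L) (vR mR)) (¬LSecond⇒LFirst-conj+nim (option+mex-¬LSecond mL))

  mex-nimLike : NimLike G m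
  mex-nimLike = form-ind (λ X → WeaklyImpartial X → Equivalent X) (λ _ → ≈ᴸ-refl) (λ _ → ≈ᴸ-refl) step
    where
    step : ∀ XL XR → (∀ {L} → L ∈ XL → WeaklyImpartial L → Equivalent L) →
      (∀ {R} → R ∈ XR → WeaklyImpartial R → Equivalent R) →
      WeaklyImpartial ⟨ XL ∣ XR ⟩ → Equivalent ⟨ XL ∣ XR ⟩
    step XL XR ihL ihR wX = record { to = G⊑mex wX ihL′ ihR′ ; from = mex⊑G wX ihL′ ihR′ }
      where
      ihL′ : ∀ {L} → L ∈ XL → Equivalent L
      ihL′ mL = ihL mL (QuietFollowers-left wX mL)
      ihR′ : ∀ {R} → R ∈ XR → Equivalent R
      ihR′ mR = ihR mR (QuietFollowers-right wX mR)

NimLike-functional : ∀ {K a b} → NimLike K a → NimLike K b → a ≡ b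
NimLike-functional {a = a} {b} na nb = sym (LSecond-nim+nim⇒≡ {b} {a}
  (second (to (nb (nim a) (nim-weaklyImpartial a)))
    (second (from (na (nim a) (nim-weaklyImpartial a))) (LSecond-nim+nim-self a))))

≡Im-nim-functional : ∀ {K a b} → K ≡Im nim a → K ≡Im nim b → a ≡ b
≡Im-nim-functional {a = a} {b} ea eb = sym (LSecond-nim+nim⇒≡ {b} {a}
  (proj₁ (proj₁ (proj₂ (eb (nim a) (nim-affImp a))))
    (proj₂ (proj₁ (proj₂ (ea (nim a) (nim-affImp a)))) (LSecond-nim+nim-self a))))

¬¬-bounded : ∀ {A : Set} (R : A → ℕ → Set) → (∀ {x a b} → R x a → R x b → a ≡ b) →
  ∀ xs → ¬ ¬ (∃[ N ] ∀ {x} → x ∈ xs → ∀ {w} → R x w → w < N)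
¬¬-bounded R functional [] c = c (0 , λ ())
¬¬-bounded R functional (x ∷ xs) c =
  ¬¬-bounded R functional xs λ (N , bound) → ¬¬-excluded-middle {A = ∃[ w ] R x w} λ
  { (yes (w , r)) → c (N +ℕ suc w , extend-bound bound r)
  ; (no ¬r) → c (N , λ { (here refl) r → ⊥-elim (¬r (_ , r)) ; (there m) r → bound m r })
  }
  where
  extend-bound : ∀ {N w} → (∀ {y} → y ∈ xs → ∀ {v} → R y v → v < N) → R x w →
    ∀ {y} → y ∈ x ∷ xs → ∀ {v} → R y v → v < N +ℕ suc w
  extend-bound {N} {w} _ r (here refl) r′ with functional r′ r
  ... | refl = m≤n+m (suc w) N
  extend-bound {N} {w} bound _ (there m) r′ = <-≤-trans (bound m r′) (m≤m+n N (suc w))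

mutual
  followers : Form → List Form
  followers ∞ = ∞ ∷ []
  followers ∞̄ = ∞̄ ∷ []
  followers ⟨ Ls ∣ Rs ⟩ = ⟨ Ls ∣ Rs ⟩ ∷ (followers* Ls ++ followers* Rs)

  followers* : List Form → List Form
  followers* [] = []
  followers* (G ∷ Gs) = followers G ++ followers* Gs

mutual
  Follower⇒∈followers : ∀ {K} G → Follower K G → K ∈ followers G
  Follower⇒∈followers ∞ self = here refl
  Follower⇒∈followers ∞̄ self = here refl
  Follower⇒∈followers ⟨ Ls ∣ Rs ⟩ self = here refl
  Follower⇒∈followers ⟨ Ls ∣ Rs ⟩ (viaL m f) = there (Any.++⁺ˡ (Follower⇒∈followers* Ls m f))
  Follower⇒∈followers ⟨ Ls ∣ Rs ⟩ (viaR m f) =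
    there (Any.++⁺ʳ (followers* Ls) (Follower⇒∈followers* Rs m f))

  Follower⇒∈followers* : ∀ {K H} Gs → H ∈ Gs → Follower K H → K ∈ followers* Gs
  Follower⇒∈followers* (G ∷ Gs) (here refl) f = Any.++⁺ˡ (Follower⇒∈followers G f)
  Follower⇒∈followers* (G ∷ Gs) (there m) f = Any.++⁺ʳ (followers G) (Follower⇒∈followers* Gs m f)

AvoidsValue : ℕ → Form → Set
AvoidsValue N K = ∀ {w} → NimLike K w → w ≢ N

valued-avoiding-+-nim-⊑ : ∀ {XL XR YL YR N} → AffImp ⟨ XL ∣ XR ⟩ → (∀ j → ¬ LSecond (nim j + ⟨ XL ∣ XR ⟩)) →
  Valued ⟨ YL ∣ YR ⟩ → AvoidsValue N ⟨ YL ∣ YR ⟩ → ⟨ YL ∣ YR ⟩ + nim N ⊑ ⟨ YL ∣ YR ⟩ + ⟨ XL ∣ XR ⟩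
valued-avoiding-+-nim-⊑ {XL} {XR} {YL} {YR} {N} aX ¬ls v avoids = record { first = lf ; second = ls }
  where
  X Y : Form
  X = ⟨ XL ∣ XR ⟩
  Y = ⟨ YL ∣ YR ⟩
  lf : LFirst (Y + nim N) → LFirst (Y + X)
  lf _ = Valued-elim (LFirst? (Y + X)) v nim-case moon-case
    where
    nim-case : ∀ w → NimLike Y w → LFirst (Y + X)
    nim-case w nl = first (from (nl X (proj₂ aX)))
      (symmetric-RFirst⇒LFirst (nim-symmetric w) (proj₁ aX) (¬LSecond⇒RFirst (nim w + X) (¬ls w)))
    moon-case : MoonLike Y → LFirst (Y + X)
    moon-case ml = proj₁ (ml X aX)
  ls : LSecond (Y + nim N) → LSecond (Y + X)
  ls p = Valued-elim (LSecond? (Y + X)) v nim-case moon-case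
    where
    nim-case : ∀ w → NimLike Y w → LSecond (Y + X)
    nim-case w nl = ⊥-elim (avoids nl (LSecond-nim+nim⇒≡ (second (to (nl (nim N) (nim-weaklyImpartial N))) p)))
    moon-case : MoonLike Y → LSecond (Y + X)
    moon-case ml = ⊥-elim (proj₂ (ml (nim N) (nim-affImp N)) p)

nim-⊑-in-avoiding-contexts : ∀ {XL XR} N → AffImp ⟨ XL ∣ XR ⟩ → Quiet ⟨ XL ∣ XR ⟩ →
  (∀ j → ¬ LSecond (nim j + ⟨ XL ∣ XR ⟩)) →
  ∀ Y → QuietFollowers (λ K → Valued K × AvoidsValue N K) Y → Y + nim N ⊑ Y + ⟨ XL ∣ XR ⟩
nim-⊑-in-avoiding-contexts N aX qX ¬ls =
  ⊑-in-contexts (∞∉nimsBelow N) (proj₂ qX) _ λ (v , avoids) → valued-avoiding-+-nim-⊑ aX ¬ls v avoids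

right-check⇒left-check : ∀ {XL XR} → Symmetric ⟨ XL ∣ XR ⟩ → ∞̄ ∈ XR → ∞ ∈ XL
right-check⇒left-check sy m with proj₂ sy m
... | ∞ , m∞ , _ = m∞
... | ∞̄ , _ , ()
... | ⟨ _ ∣ _ ⟩ , _ , ()

module Moon {GL GR : List Form} (sy : Symmetric ⟨ GL ∣ GR ⟩)
  (vL : ∀ {L} → L ∈ GL → QuietFollowers Valued L) (all : ∀ n → ¬ ¬ SP ⟨ GL ∣ GR ⟩ n) where

  G : Form
  G = ⟨ GL ∣ GR ⟩

  module _ {XL XR : List Form} (aX : AffImp ⟨ XL ∣ XR ⟩) where

    X : Form
    X = ⟨ XL ∣ XR ⟩

    SP⇒LFirst-+ : ∀ {n} → LSecond (nim n + X) → SP G n → LFirst (G + X)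
    SP⇒LFirst-+ ls (inj₁ (L , mL , L≡*n)) = LFirst-+ˡ mL (proj₂ (proj₁ (proj₂ (L≡*n X aX))) ls)
    SP⇒LFirst-+ ls (inj₂ (inj₁ ∞∈GL)) = LFirst-+ˡ ∞∈GL ls∞
    SP⇒LFirst-+ {n} ls (inj₂ (inj₂ (L , mL , _ , (_ , p)))) =
      LFirst-+ˡ mL (second (nim-⊑-in-contexts n (proj₂ aX) ls L (vL mL)) p)

    -- N exceeds the values of all immediate nimbers and of all nimber-like followers of
    -- G, so *N is protected by a check L, and L + X inherits Left's win from L + *N.
    ¬¬LFirst-+-against-nimless : Quiet X → (∀ j → ¬ LSecond (nim j + X)) → ¬ ¬ LFirst (G + X)
    ¬¬LFirst-+-against-nimless qX ¬ls ¬lf =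
      ¬¬-bounded (λ K w → K ≡Im nim w) ≡Im-nim-functional GL λ (N₁ , immediate<N₁) →
      ¬¬-bounded NimLike NimLike-functional (followers G) λ (N₂ , values<N₂) →
      all (N₁ +ℕ N₂) λ
        { (inj₁ (L , mL , L≡*N)) → <⇒≱ (immediate<N₁ mL L≡*N) (m≤m+n N₁ N₂)
        ; (inj₂ (inj₁ ∞∈GL)) → ¬lf (LFirst-+ˡ ∞∈GL ls∞)
        ; (inj₂ (inj₂ (L , mL , _ , (_ , p)))) →
            ¬lf (LFirst-+ˡ mL (second (nim-⊑-in-avoiding-contexts _ aX qX ¬ls L (avoiding values<N₂ mL)) p))
        }
      where
      avoiding : ∀ {N₁ N₂ L} → (∀ {K} → K ∈ followers G → ∀ {w} → NimLike K w → w < N₂) → L ∈ GL →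
        QuietFollowers (λ K → Valued K × AvoidsValue (N₁ +ℕ N₂) K) L
      avoiding {N₁} {N₂} values<N₂ mL K f q =
        vL mL K f q ,
        λ nl w≡N → <⇒≱ (subst (_< N₂) w≡N (values<N₂ (Follower⇒∈followers G (viaL mL f)) nl)) (m≤n+m N₂ N₁)

    quiet⇒LFirst-+ : Quiet X → LFirst (G + X)
    quiet⇒LFirst-+ qX = decidable-stable (LFirst? (G + X)) λ ¬lf →
      ¬¬-excluded-middle {A = ∃[ n ] LSecond (nim n + X)} λ
        { (yes (n , ls)) → all n λ sp → ¬lf (SP⇒LFirst-+ ls sp)
        ; (no ¬ls) → ¬¬LFirst-+-against-nimless qX (λ j ls → ¬ls (j , ls)) ¬lf
        }

  moonLike : MoonLike G
  moonLike ⟨ XL ∣ XR ⟩ aX =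
    lf , RFirst⇒¬LSecond (G + ⟨ XL ∣ XR ⟩) (symmetric-LFirst⇒RFirst sy (proj₁ aX) lf)
    where
    lf : LFirst (G + ⟨ XL ∣ XR ⟩)
    lf with shape XL XR
    ... | left-check m = LFirst-+ʳ m ls∞
    ... | right-check m = LFirst-+ʳ (right-check⇒left-check (proj₁ aX) m) ls∞
    ... | quiet q = quiet⇒LFirst-+ aX q

moon-moonLike : MoonLike moon
moon-moonLike ⟨ XL ∣ XR ⟩ _ =
  LFirst-+ˡ {∞ ∷ []} {∞̄ ∷ []} {XL} {XR} (here refl) ls∞ ,
  right-checkˡ-¬LSecond {∞ ∷ []} {∞̄ ∷ []} {XL} {XR} (here refl)

moonLike⇒≡Im : ∀ {A B} → MoonLike A → MoonLike B → A ≡Im B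
moonLike⇒≡Im mA mB X aX = sameOutcome-fromLeft
  ((λ _ → proj₁ (mB X aX)) , (λ _ → proj₁ (mA X aX)))
  ((λ p → ⊥-elim (proj₂ (mA X aX) p)) , (λ p → ⊥-elim (proj₂ (mB X aX) p)))

¬¬-below-or-mex : (P : ℕ → Set) → ∀ n → ¬ ¬ ((∀ k → k < n → P k) ⊎ ∃[ m ] IsMex P m)
¬¬-below-or-mex P zero c = c (inj₁ λ _ ())
¬¬-below-or-mex P (suc n) c = ¬¬-below-or-mex P n λ
  { (inj₂ mex) → c (inj₂ mex)
  ; (inj₁ below) → ¬¬-excluded-middle {A = P n} λ
      { (yes p) → c (inj₁ (extend below p))
      ; (no ¬p) → c (inj₂ (n , ¬p , below))
      }
  }
  where
  extend : (∀ k → k < n → P k) → P n → ∀ k → k < suc n → P k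
  extend below p k k<1+n with m<1+n⇒m<n∨m≡n k<1+n
  ... | inj₁ k<n = below k k<n
  ... | inj₂ refl = p

¬¬-all-or-mex : (P : ℕ → Set) → ¬ ¬ ((∀ n → ¬ ¬ P n) ⊎ ∃[ m ] IsMex P m)
¬¬-all-or-mex P c = c (inj₁ λ n ¬p → ¬¬-below-or-mex P (suc n) λ
  { (inj₁ below) → ¬p (below n (n<1+n n))
  ; (inj₂ mex) → c (inj₂ mex)
  })

quietFollowersValued : ∀ G → WeaklyImpartial G → QuietFollowers Valued G
quietFollowersValued = form-ind (λ G → WeaklyImpartial G → QuietFollowers Valued G)
  (λ { _ _ self () }) (λ { _ _ self () }) step
  where
  step : ∀ Ls Rs → (∀ {L} → L ∈ Ls → WeaklyImpartial L → QuietFollowers Valued L) →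
    (∀ {R} → R ∈ Rs → WeaklyImpartial R → QuietFollowers Valued R) →
    WeaklyImpartial ⟨ Ls ∣ Rs ⟩ → QuietFollowers Valued ⟨ Ls ∣ Rs ⟩
  step Ls Rs ihL ihR w K (viaL m f) = ihL m (QuietFollowers-left w m) K f
  step Ls Rs ihL ihR w K (viaR m f) = ihR m (QuietFollowers-right w m) K f
  step Ls Rs ihL ihR w _ self q c = ¬¬-all-or-mex (SP ⟨ Ls ∣ Rs ⟩) λ
    { (inj₁ all) → c (inj₂ (Moon.moonLike (w _ self q) vL all))
    ; (inj₂ (m , mex)) → c (inj₁ (m , Mex.mex-nimLike (w _ self q) vL vR mex))
    }
    where
    vL : ∀ {L} → L ∈ Ls → QuietFollowers Valued L
    vL m = ihL m (QuietFollowers-left w m)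
    vR : ∀ {R} → R ∈ Rs → QuietFollowers Valued R
    vR m = ihR m (QuietFollowers-right w m)

theorem3p25 : (G : Form) → AffImp G →
    (((∀ n → SP G n) → (G ≡Im moon) × MexIsInfinite (SP G)) ×
     ((¬ (∀ n → SP G n)) → ∀ m → IsMex (SP G) m → G ≡Im nim m))
theorem3p25 ⟨ Ls ∣ Rs ⟩ (sy , w) =
  (λ all → moonLike⇒≡Im (Moon.moonLike sy vL λ n ¬sp → ¬sp (all n)) moon-moonLike , all) ,
  (λ _ m mex → nimLike⇒≡Im (Mex.mex-nimLike sy vL vR mex))
  where
  vL : ∀ {L} → L ∈ Ls → QuietFollowers Valued L
  vL m = quietFollowersValued _ (QuietFollowers-left w m)
  vR : ∀ {R} → R ∈ Rs → QuietFollowers Valued R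
  vR m = quietFollowersValued _ (QuietFollowers-right w m)
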